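{- Let $T$ be a based scheme on $X$, $U$ a based scheme on $Y$, $\tau=\tau_T$, and $\zeta$ an action of $U$ on $T$. Let $u\in U$ and $t\in\tau$, and let $\hat t^*$ be any element of $\{t^*\}\zeta_{u^*}\subseteq\tau$. Then $[u,t]^*=[u^*,\hat t^*]$; in particular $[u,t]^*\in U\ltimes_\zeta T$.
   Context: All schemes are association schemes on finite sets; $s^*$ is the transpose relation. Complex product $pq=\{r:a_{pqr}>0\}$; closed: $T'^*T'\subseteq T'$; normal: $pT'=T'p$ for all $p$. For closed $T'$: $xT'=\bigcup_{t\in T'}xt$, $X/T'=\{xT'\}$, $t^{T'}=\{(x_1T',x_2T'):(x_1',x_2')\in t$ for some $x_i'\in x_iT'\}$, $T/\!\!/T'=\{t^{T'}\}$. Morphisms of schemes: maps of points preserving "same relation"; isomorphisms bijective on points and relations. Based schemes carry basepoints; based morphisms preserve them. Category $\mathcal C$: $\phi\in\mathrm{Hom}_{\mathcal C}(T,U)$ is $(T_\phi,U_\phi,\tilde\phi)$, $T_\phi,U_\phi$ normal closed, $\tilde\phi:T/\!\!/T_\phi\to U/\!\!/U_\phi$ a based isomorphism. Composition with $\psi\in\mathrm{Hom}_{\mathcal C}(U,V)$ ($V$ on $W$): $T_{\phi\psi}=\{t:\exists u,\ t^{T_\phi}\tilde\phi=u^{U_\phi},\ u^{U_\psi}\tilde\psi=1_W^{V_\psi}\}$, $V_{\phi\psi}=\{v:\exists u,\ 1_X^{T_\phi}\tilde\phi=u^{U_\phi},\ u^{U_\psi}\tilde\psi=v^{V_\psi}\}$,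 $(xT_{\phi\psi})\widetilde{\phi\psi}=wV_{\phi\psi}$ with $(xT_\phi)\tilde\phi=yU_\phi$, $(yU_\psi)\tilde\psi=wV_\psi$. $\mathrm{id}_T=(\{1_X\},\{1_X\},\mathrm{id})$. $\phi\le\psi$: $T_\phi\subseteq T_\psi$, $U_\phi\subseteq U_\psi$, $(xT_\phi)\tilde\phi\subseteq(xT_\psi)\tilde\psi$ for all $x$. $\phi^*$: same subsets, isomorphism $\tilde\phi^{ -1}$. $\tau=\tau_T$: the set $T$ with involution, distinguished $1=1_X$, constants $a_{pqr}$. A $\tau$-scheme: $(T',\alpha)$, $\alpha:\tau\to T'$ bijective, $1\alpha$ diagonal, $(p^*)\alpha=(p\alpha)^*$, $a_{(p\alpha)(q\alpha)(r\alpha)}=a_{pqr}$. For $\tau$-schemes $(T_1,\alpha),(T_2,\beta)$, $\phi\in\mathrm{Hom}_{\mathcal C}(T_1,T_2)$: $\phi(\tau)(P)=\{u:(t\alpha)^{(T_1)_\phi}\tilde\phi=(u\beta)^{(T_2)_\phi}$ for some $t\in P\}$. Action $\zeta$ of $U$ ($Y$, basepoint $y_*$) on $T$ ($X$): $\tau$-schemes $\zeta_y=(T_y,\alpha^y)$ on $X$ and $\zeta_{y_1}^{y_2}\in\mathrm{Hom}_{\mathcal C}(T_{y_1},T_{y_2})$ with (1) $T_{y_*}=T$, $\alpha^{y_*}=\mathrm{id}$; (2) $\zeta_y^y=\mathrm{id}$; (3) $\zeta_{y_2}^{y_1}=(\zeta_{y_1}^{y_2})^*$; (4) $\zeta_{y_1}^{y_2}(\tau)$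 depends only on the $u\in U$ containing $(y_1,y_2)$, and is denoted $\zeta_u$; (5) $\zeta_{y_1}^{y_3}\le\zeta_{y_1}^{y_2}\zeta_{y_2}^{y_3}$. $T'_{y_1y_2}=(T_{y_1})_{\zeta_{y_1}^{y_2}}$, $T''_{y_1y_2}=(T_{y_2})_{\zeta_{y_1}^{y_2}}$. $[u,t]$ is the set of $((y_1,x_1),(y_2,x_2))$ with $(y_1,y_2)\in u$ and $((x_1T'_{y_1y_2})\tilde\zeta_{y_1}^{y_2},x_2T''_{y_1y_2})\in(t\alpha^{y_2})^{T''_{y_1y_2}}$; $U\ltimes_\zeta T=\{[u,t]:u\in U,t\in\tau\}$. -}

module Defs where

open import Data.Nat using (ℕ; zero; suc; _+_; _<_)
open import Data.Fin using (Fin; zero; suc; _≟_)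
open import Data.Bool using (Bool; true; false; _∧_)
open import Data.Product using (Σ; ∃; ∃-syntax; _×_; _,_)
open import Function.Bundles using (_⇔_)
open import Relation.Nullary.Decidable using (⌊_⌋)
open import Relation.Binary.PropositionalEquality using (_≡_)

countF : ∀ {n} → (Fin n → Bool) → ℕ
countF {zero}  f = 0
countF {suc n} f with f zero
... | true  = suc (countF (λ i → f (suc i)))
... | false = countF (λ i → f (suc i))

-- A scheme on the point set X = Fin n whose relations are labelled by
-- Fin m: rel x y is the (label of the) relation containing (x , y).
-- Surjectivity of rel makes the labels correspond bijectively to the
-- relations.  one = label of 1_X, tr = transpose (s ↦ s*),
-- a p q r = intersection numbers a_{pqr}.

record IsScheme {n m : ℕ} (rel : Fin n → Fin n → Fin m) (one : Fin m)
                (tr : Fin m → Fin m) (a : Fin m → Fin m → Fin m → ℕ) : Set where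
  field
    surj  : ∀ r → ∃[ x ] ∃[ y ] (rel x y ≡ r)
    diag  : ∀ x y → (rel x y ≡ one) ⇔ (x ≡ y)
    trans : ∀ x y → rel y x ≡ tr (rel x y)
    const : ∀ p q x y →
            countF (λ z → ⌊ rel x z ≟ p ⌋ ∧ ⌊ rel z y ≟ q ⌋) ≡ a p q (rel x y)

record Scheme (n m : ℕ) : Set where
  field
    rel : Fin n → Fin n → Fin m
    one : Fin m
    tr  : Fin m → Fin m
    a   : Fin m → Fin m → Fin m → ℕ
    isScheme : IsScheme rel one tr a
open Scheme public

RSub : ℕ → Set₁
RSub m = Fin m → Set

-- closed: T'* T' ⊆ T' (closed subsets are nonempty, i.e. contain 1;
-- this is forced by T//T' being a scheme)
Closed : ∀ {n m} → Scheme n m → RSub m → Set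
Closed T S = S (one T) ×
  (∀ p q r → S p → S q → 0 < a T (tr T p) q r → S r)

-- normal: pT' = T'p for all p
Normal : ∀ {n m} → Scheme n m → RSub m → Set
Normal T S = ∀ p r →
  (∃[ q ] (S q × 0 < a T p q r)) ⇔ (∃[ q ] (S q × 0 < a T q p r))

NormalClosed : ∀ {n m} → Scheme n m → RSub m → Set
NormalClosed T S = Closed T S × Normal T S

-- Cosets xT' are represented by representatives x;  x' ∈ xT'  iff  rel x x' ∈ T'.
InCoset : ∀ {n m} → Scheme n m → RSub m → Fin n → Fin n → Set
InCoset T S x x' = S (rel T x x')

QRel : ∀ {n m} → Scheme n m → RSub m → Fin m → Fin n → Fin n → Set
QRel T S t x₁ x₂ =
  ∃[ x₁' ] ∃[ x₂' ] (InCoset T S x₁ x₁' × InCoset T S x₂ x₂' × rel T x₁' x₂' ≡ t)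

SameQ : ∀ {n m} → Scheme n m → RSub m → Fin n → Fin n → Fin n → Fin n → Set
SameQ T S x₁ x₂ x₃ x₄ = ∃[ t ] (QRel T S t x₁ x₂ × QRel T S t x₃ x₄)

-- Category C.  A (pre)morphism T → U consists of T_φ, U_φ and a map of
-- cosets X/T_φ → Y/U_φ given on representatives.

record PreHom {n m k l : ℕ} (T : Scheme n m) (U : Scheme k l) : Set₁ where
  field
    Tsub : RSub m
    Usub : RSub l
    map  : Fin n → Fin k
open PreHom public

-- φ ∈ Hom_C(T,U) for based schemes (T, x*) and (U, y*):
-- T_φ, U_φ normal closed, and φ̃ a based isomorphism T//T_φ → U//U_φ.
record IsHom {n m k l : ℕ} (T : Scheme n m) (U : Scheme k l)
             (x* : Fin n) (y* : Fin k) (φ : PreHom T U) : Set where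
  field
    Tnc   : NormalClosed T (Tsub φ)
    Unc   : NormalClosed U (Usub φ)
    wd    : ∀ x x' → InCoset T (Tsub φ) x x' →
              InCoset U (Usub φ) (map φ x) (map φ x')
    inj   : ∀ x x' → InCoset U (Usub φ) (map φ x) (map φ x') →
              InCoset T (Tsub φ) x x'
    surj  : ∀ y → ∃[ x ] InCoset U (Usub φ) (map φ x) y
    based : InCoset U (Usub φ) (map φ x*) y*
    pres  : ∀ a b c d → SameQ T (Tsub φ) a b c d →
              SameQ U (Usub φ) (map φ a) (map φ b) (map φ c) (map φ d)
    refl  : ∀ a b c d →
              SameQ U (Usub φ) (map φ a) (map φ b) (map φ c) (map φ d) →
              SameQ T (Tsub φ) a b c d

RelImgEq : ∀ {n m k l} {T : Scheme n m} {U : Scheme k l} →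
           PreHom T U → Fin m → Fin l → Set
RelImgEq {T = T} {U} φ t u = ∀ c d →
  (∃[ a ] ∃[ b ] (QRel T (Tsub φ) t a b ×
                   InCoset U (Usub φ) (map φ a) c ×
                   InCoset U (Usub φ) (map φ b) d))
  ⇔ QRel U (Usub φ) u c d

_∘C_ : ∀ {n m k l p q} {T : Scheme n m} {U : Scheme k l} {V : Scheme p q} →
       PreHom T U → PreHom U V → PreHom T V
_∘C_ {T = T} {U} {V} φ ψ = record
  { Tsub = λ t → ∃[ u ] (RelImgEq φ t u × RelImgEq ψ u (one V))
  ; Usub = λ v → ∃[ u ] (RelImgEq φ (one T) u × RelImgEq ψ u v)
  ; map  = λ x → map ψ (map φ x)
  }

idC : ∀ {n m} (T : Scheme n m) → PreHom T T
idC T = record { Tsub = λ t → t ≡ one T ; Usub = λ t → t ≡ one T ; map = λ x → x }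

_≈C_ : ∀ {n m k l} {T : Scheme n m} {U : Scheme k l} → PreHom T U → PreHom T U → Set
_≈C_ {T = T} {U} φ ψ =
  (∀ t → Tsub φ t ⇔ Tsub ψ t) × (∀ u → Usub φ u ⇔ Usub ψ u) ×
  (∀ x → InCoset U (Usub φ) (map φ x) (map ψ x))

_≤C_ : ∀ {n m k l} {T : Scheme n m} {U : Scheme k l} → PreHom T U → PreHom T U → Set
_≤C_ {T = T} {U} φ ψ =
  (∀ t → Tsub φ t → Tsub ψ t) × (∀ u → Usub φ u → Usub ψ u) ×
  (∀ x y → InCoset U (Usub φ) (map φ x) y → InCoset U (Usub ψ) (map ψ x) y)

-- ψ = φ*  (same subsets, ψ̃ = φ̃⁻¹)
IsStarOf : ∀ {n m k l} {T : Scheme n m} {U : Scheme k l} →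
           PreHom U T → PreHom T U → Set
IsStarOf {T = T} {U} ψ φ =
  (∀ u → Tsub ψ u ⇔ Usub φ u) × (∀ t → Usub ψ t ⇔ Tsub φ t) ×
  (∀ x → InCoset T (Tsub φ) x (map ψ (map φ x))) ×
  (∀ y → InCoset U (Usub φ) y (map φ (map ψ y)))

-- τ = τ_T and τ-schemes.  A τ-scheme (T',α) on X is encoded by labelling
-- its relations with τ via α, i.e. as a scheme on X with labels Fin m
-- having the same 1, involution and constants as T.

record τScheme {n m : ℕ} (T : Scheme n m) : Set where
  field
    scheme  : Scheme n m
    oneEq   : one scheme ≡ one T
    trEq    : ∀ p → tr scheme p ≡ tr T p
    aEq     : ∀ p q r → a scheme p q r ≡ a T p q r
open τScheme public

τImg : ∀ {n m} {T : Scheme n m} {S₁ S₂ : Scheme n m} →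
       PreHom S₁ S₂ → RSub m → RSub m
τImg φ P u = ∃[ t ] (P t × RelImgEq φ t u)

record Action {n m k l : ℕ} (T : Scheme n m) (x* : Fin n)
              (U : Scheme k l) (y* : Fin k) : Set₁ where
  field
    Ts    : Fin k → τScheme T
    hom   : ∀ y₁ y₂ → PreHom (scheme (Ts y₁)) (scheme (Ts y₂))
    isHom : ∀ y₁ y₂ → IsHom (scheme (Ts y₁)) (scheme (Ts y₂)) x* x* (hom y₁ y₂)
    ax1   : ∀ x x' → rel (scheme (Ts y*)) x x' ≡ rel T x x'
    ax2   : ∀ y → hom y y ≈C idC (scheme (Ts y))
    ax3   : ∀ y₁ y₂ → IsStarOf (hom y₂ y₁) (hom y₁ y₂)
    ax4   : ∀ y₁ y₂ y₁' y₂' → rel U y₁ y₂ ≡ rel U y₁' y₂' →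
              ∀ (P : RSub m) t →
              τImg {T = T} (hom y₁ y₂) P t ⇔ τImg {T = T} (hom y₁' y₂') P t
    ax5   : ∀ y₁ y₂ y₃ → hom y₁ y₃ ≤C (hom y₁ y₂ ∘C hom y₂ y₃)
open Action public

-- ζ_u(P)  (well defined by ax4)
ζ[_] : ∀ {n m k l} {T : Scheme n m} {x* : Fin n} {U : Scheme k l} {y* : Fin k} →
       Action T x* U y* → Fin l → RSub m → RSub m
ζ[_] {T = T} {U = U} ζ u P s =
  ∃[ y₁ ] ∃[ y₂ ] (rel U y₁ y₂ ≡ u × τImg {T = T} (hom ζ y₁ y₂) P s)

SD : ∀ {n m k l} {T : Scheme n m} {x* : Fin n} {U : Scheme k l} {y* : Fin k} →
     Action T x* U y* → Fin l → Fin m → (Fin k × Fin n) → (Fin k × Fin n) → Set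
SD {U = U} ζ u t (y₁ , x₁) (y₂ , x₂) =
  rel U y₁ y₂ ≡ u ×
  QRel (scheme (Ts ζ y₂)) (Usub (hom ζ y₁ y₂)) t (map (hom ζ y₁ y₂) x₁) x₂

-- A pair ((y₁,x₁),(y₂,x₂)) lies in [u,t] iff ζ̃_{y₁}^{y₂}(x₁T') and x₂T'' are
-- t-related in the fibre over y₂.  Because ζ_{y₂}^{y₁} = (ζ_{y₁}^{y₂})*, the
-- subset T'' dividing that fibre is also the source subset of ζ_{y₂}^{y₁}, and
-- ζ̃_{y₂}^{y₁} inverts ζ̃_{y₁}^{y₂} on cosets.  So transposing the pair turns t
-- into t*, and transporting along the isomorphism ζ̃_{y₂}^{y₁} turns (t*)^{T''}
-- into the relation that ζ_{u*} assigns to t*, which is t̂* by axiom (4).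
module Submission where

open import Defs
open import Level using (0ℓ)
open import Data.Nat using (ℕ; suc; _<_; z≤n; s≤s)
open import Data.Fin using (Fin; zero; suc; _≟_)
open import Data.Bool using (Bool; true; false; T; _∧_)
open import Data.Bool.Properties using (T-∧)
open import Data.Empty using (⊥-elim)
open import Data.Product using (_×_; ∃-syntax; _,_; proj₁; proj₂)
open import Function.Bundles using (_⇔_; Equivalence; mk⇔)
open import Function.Properties.Equivalence using (⇔-setoid) renaming (sym to sym⇔)
open import Relation.Nullary.Decidable using (⌊_⌋; fromWitness)
open import Relation.Binary.PropositionalEquality
  using (_≡_; refl; sym; trans; cong; subst)

open Equivalence

countF-pos : ∀ {n} (f : Fin n → Bool) (i : Fin n) → T (f i) → 0 < countF f
countF-pos {suc n} f i fi with f zero in f0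
... | true = s≤s z≤n
countF-pos {suc n} f zero    fi | false = ⊥-elim (subst T f0 fi)
countF-pos {suc n} f (suc i) fi | false = countF-pos (λ j → f (suc j)) i fi

module SchemeProperties {n m : ℕ} (S : Scheme n m) where
  private module S = IsScheme (isScheme S)

  a-pos : ∀ x y z → 0 < a S (rel S x z) (rel S z y) (rel S x y)
  a-pos x y z = subst (0 <_) (S.const (rel S x z) (rel S z y) x y)
    (countF-pos (λ w → ⌊ rel S x w ≟ rel S x z ⌋ ∧ ⌊ rel S w y ≟ rel S z y ⌋) z
      (from (T-∧ {⌊ rel S x z ≟ rel S x z ⌋}) (fromWitness refl , fromWitness refl)))

  tr-involutive : ∀ p → tr S (tr S p) ≡ p
  tr-involutive p with S.surj p
  ... | x , y , refl = trans (cong (tr S) (sym (S.trans x y))) (sym (S.trans y x))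

  rel-flip⇔ : ∀ x y u → (rel S x y ≡ u) ⇔ (rel S y x ≡ tr S u)
  rel-flip⇔ x y u = mk⇔
    (λ e → trans (S.trans x y) (cong (tr S) e))
    (λ e → trans (S.trans y x) (trans (cong (tr S) e) (tr-involutive u)))

  module _ {P : RSub m} (closed : Closed S P) where

    -- rel x z ∈ (rel y x)* (rel y z), witnessed by the middle point y.
    InCoset-euclidean : ∀ {x y z} → InCoset S P y x → InCoset S P y z → InCoset S P x z
    InCoset-euclidean {x} {y} {z} yx yz = proj₂ closed _ _ _ yx yz
      (subst (λ p → 0 < a S p (rel S y z) (rel S x z)) (S.trans y x) (a-pos x z y))

    InCoset-refl : ∀ x → InCoset S P x x
    InCoset-refl x = subst P (sym (from (S.diag x x) refl)) (proj₁ closed)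

    InCoset-sym : ∀ {x y} → InCoset S P x y → InCoset S P y x
    InCoset-sym {x} xy = InCoset-euclidean xy (InCoset-refl x)

    InCoset-trans : ∀ {x y z} → InCoset S P x y → InCoset S P y z → InCoset S P x z
    InCoset-trans xy yz = InCoset-euclidean (InCoset-sym xy) yz

    QRel-resp : ∀ {t x x' y y'} → InCoset S P x x' → InCoset S P y y' →
                QRel S P t x y → QRel S P t x' y'
    QRel-resp xx' yy' (x₀ , y₀ , xx₀ , yy₀ , e) =
      x₀ , y₀ , InCoset-trans (InCoset-sym xx') xx₀ , InCoset-trans (InCoset-sym yy') yy₀ , e

    QRel-resp⇔ : ∀ {t x x' y y'} → InCoset S P x x' → InCoset S P y y' →
                 QRel S P t x y ⇔ QRel S P t x' y'
    QRel-resp⇔ xx' yy' =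
      mk⇔ (QRel-resp xx' yy') (QRel-resp (InCoset-sym xx') (InCoset-sym yy'))

  QRel-flip : ∀ {P t x y} → QRel S P t x y → QRel S P (tr S t) y x
  QRel-flip (x₀ , y₀ , xx₀ , yy₀ , e) =
    y₀ , x₀ , yy₀ , xx₀ , trans (S.trans x₀ y₀) (cong (tr S) e)

  QRel-flip⇔ : ∀ {P t x y} → QRel S P t x y ⇔ QRel S P (tr S t) y x
  QRel-flip⇔ {P} {t} {x} {y} = mk⇔ (QRel-flip {P})
    (λ q → subst (λ s → QRel S P s x y) (tr-involutive t) (QRel-flip {P} q))

  QRel-subst⇔ : ∀ {P Q t x y} → (∀ r → P r ⇔ Q r) → QRel S P t x y ⇔ QRel S Q t x y
  QRel-subst⇔ P⇔Q = mk⇔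
    (λ (x₀ , y₀ , xx₀ , yy₀ , e) → x₀ , y₀ , to (P⇔Q _) xx₀ , to (P⇔Q _) yy₀ , e)
    (λ (x₀ , y₀ , xx₀ , yy₀ , e) → x₀ , y₀ , from (P⇔Q _) xx₀ , from (P⇔Q _) yy₀ , e)

open SchemeProperties

module _ {n m k l : ℕ} {S₁ : Scheme n m} {S₂ : Scheme k l} {b₁ : Fin n} {b₂ : Fin k}
         {φ : PreHom S₁ S₂} (hom : IsHom S₁ S₂ b₁ b₂ φ) where
  private
    closed₁ : Closed S₁ (Tsub φ)
    closed₁ = proj₁ (IsHom.Tnc hom)
    closed₂ : Closed S₂ (Usub φ)
    closed₂ = proj₁ (IsHom.Unc hom)

  RelImgEq⇒QRel-map⇔ : ∀ {t u} → RelImgEq φ t u → ∀ x y →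
                       QRel S₁ (Tsub φ) t x y ⇔ QRel S₂ (Usub φ) u (map φ x) (map φ y)
  RelImgEq⇒QRel-map⇔ t↦u x y = mk⇔
    (λ q → to (t↦u _ _) (x , y , q , InCoset-refl S₂ closed₂ _ , InCoset-refl S₂ closed₂ _))
    (λ q → let (x' , y' , q' , x'x , y'y) = from (t↦u _ _) q
           in QRel-resp S₁ closed₁ (IsHom.inj hom x' x x'x) (IsHom.inj hom y' y y'y) q')

module _ {n m k l : ℕ} {S₁ : Scheme n m} {S₂ : Scheme k l} {b₁ : Fin n} {b₂ : Fin k}
         {φ : PreHom S₁ S₂} {ψ : PreHom S₂ S₁}
         (homψ : IsHom S₂ S₁ b₂ b₁ ψ) (star : IsStarOf ψ φ) where
  open import Relation.Binary.Reasoning.Setoid (⇔-setoid 0ℓ)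

  QRel-transpose⇔ : ∀ {t ŝ} → RelImgEq ψ (tr S₂ t) ŝ → ∀ x y →
                    QRel S₂ (Usub φ) t (map φ x) y ⇔ QRel S₁ (Usub ψ) ŝ (map ψ y) x
  QRel-transpose⇔ {t} {ŝ} t*↦ŝ x y = begin
    QRel S₂ (Usub φ) t (map φ x) y                     ≈⟨ QRel-subst⇔ S₂ (λ r → sym⇔ (proj₁ star r)) ⟩
    QRel S₂ (Tsub ψ) t (map φ x) y                     ≈⟨ QRel-flip⇔ S₂ {Tsub ψ} ⟩
    QRel S₂ (Tsub ψ) (tr S₂ t) y (map φ x)             ≈⟨ RelImgEq⇒QRel-map⇔ homψ t*↦ŝ y (map φ x) ⟩
    QRel S₁ (Usub ψ) ŝ (map ψ y) (map ψ (map φ x))     ≈⟨ QRel-resp⇔ S₁ closedψ (InCoset-refl S₁ closedψ (map ψ y)) ψφx~x ⟩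
    QRel S₁ (Usub ψ) ŝ (map ψ y) x                     ∎
    where
    closedψ : Closed S₁ (Usub ψ)
    closedψ = proj₁ (IsHom.Unc homψ)
    ψφx~x : InCoset S₁ (Usub ψ) (map ψ (map φ x)) x
    ψφx~x = InCoset-sym S₁ closedψ (from (proj₁ (proj₂ star) _) (proj₁ (proj₂ (proj₂ star)) x))

module _ {n m k l : ℕ} {T : Scheme n m} {x* : Fin n} {U : Scheme k l} {y* : Fin k}
         (ζ : Action T x* U y*) where

  ζ-singleton⇒RelImgEq : ∀ {u t ŝ} → ζ[ ζ ] u (λ s → s ≡ t) ŝ →
                         ∀ y₁ y₂ → rel U y₁ y₂ ≡ u → RelImgEq (hom ζ y₁ y₂) t ŝ
  ζ-singleton⇒RelImgEq {t = t} {ŝ} (z₁ , z₂ , z₁z₂∈u , img) y₁ y₂ y₁y₂∈u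
    with to (ax4 ζ z₁ z₂ y₁ y₂ (trans z₁z₂∈u (sym y₁y₂∈u)) (λ s → s ≡ t) ŝ) img
  ... | .t , refl , t↦ŝ = t↦ŝ

  SD-transpose⇔ : ∀ {u t ŝ} → ζ[ ζ ] (tr U u) (λ s → s ≡ tr T t) ŝ →
                  ∀ p q → SD ζ u t q p ⇔ SD ζ (tr U u) ŝ p q
  SD-transpose⇔ {u} {t} {ŝ} ζu*t*∋ŝ (y₂ , x₂) (y₁ , x₁) = mk⇔
    (λ (e , q) → let e* = to (rel-flip⇔ U y₁ y₂ u) e in e* , to (fibre-transpose⇔ e*) q)
    (λ (e* , q) → from (rel-flip⇔ U y₁ y₂ u) e* , from (fibre-transpose⇔ e*) q)
    where
    fibre-transpose⇔ : rel U y₂ y₁ ≡ tr U u →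
      QRel (scheme (Ts ζ y₂)) (Usub (hom ζ y₁ y₂)) t (map (hom ζ y₁ y₂) x₁) x₂ ⇔
      QRel (scheme (Ts ζ y₁)) (Usub (hom ζ y₂ y₁)) ŝ (map (hom ζ y₂ y₁) x₂) x₁
    fibre-transpose⇔ y₂y₁∈u* =
      QRel-transpose⇔ (isHom ζ y₂ y₁) (ax3 ζ y₁ y₂)
        (subst (λ s → RelImgEq (hom ζ y₂ y₁) s ŝ) (sym (trEq (Ts ζ y₂) t))
          (ζ-singleton⇒RelImgEq ζu*t*∋ŝ y₂ y₁ y₂y₁∈u*))
        x₁ x₂

lemma4p6 : ∀ {n m k l : ℕ} (T : Scheme n m) (x* : Fin n) (U : Scheme k l) (y* : Fin k)
             (ζ : Action T x* U y*) (u : Fin l) (t : Fin m) (t̂* : Fin m) →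
             ζ[ ζ ] (tr U u) (λ s → s ≡ tr T t) t̂* →
             (∀ p q → SD ζ u t q p ⇔ SD ζ (tr U u) t̂* p q)
             × (∃[ u' ] ∃[ t' ] (∀ p q → SD ζ u t q p ⇔ SD ζ u' t' p q))
lemma4p6 T x* U y* ζ u t t̂* ζu*t*∋t̂* =
  SD-transpose⇔ ζ ζu*t*∋t̂* , (tr U u , t̂* , SD-transpose⇔ ζ ζu*t*∋t̂*)
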